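{- If $G$ is a block graph, then $\mathrm{nim}(\mathrm{GEN}(G))=\mathrm{pty}(V)$.
   Context: A block of a graph is a maximal connected subgraph without a cut vertex; a block graph is a graph all of whose blocks are complete graphs. For a graph $G=(V,E)$, a set of vertices is geodetically convex if it contains every vertex on every shortest path between two of its vertices; the convex hull $[P]$ is the smallest convex set containing $P$, and $P$ is generating if $[P]=V$. In the achievement game $\mathrm{GEN}(G)$, two players alternately select previously-unselected vertices; the game ends as soon as the selected set generates, and the last player to move wins. $\mathrm{nim}$ denotes the nim-number of an impartial game, and $\mathrm{pty}(V):=|V|\bmod 2$. -}

module Defs where

open import Data.Nat using (ℕ; zero; suc; _≤_; _<_)
open import Data.Fin using (Fin)
open import Data.Fin.Subset using (Subset; _∈_; _∉_; _⊆_; _∪_; ⁅_⁆)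
open import Data.Bool using (Bool; true; false)
open import Data.Product using (_×_; ∃; Σ; _,_)
open import Relation.Nullary using (¬_)
open import Relation.Binary.PropositionalEquality using (_≡_; _≢_)

record Graph (n : ℕ) : Set where
  field
    adj        : Fin n → Fin n → Bool
    adj-sym    : ∀ u v → adj u v ≡ adj v u
    adj-irrefl : ∀ v → adj v v ≡ false

module _ {n : ℕ} (G : Graph n) where
  open Graph G

  Adj : Fin n → Fin n → Set
  Adj u v = adj u v ≡ true

  data Walk : Fin n → Fin n → ℕ → Set where
    here : ∀ {u} → Walk u u 0
    step : ∀ {u w v k} → Adj u w → Walk w v k → Walk u v (suc k)

  data OnWalk (x : Fin n) : ∀ {u v k} → Walk u v k → Set where
    first : ∀ {v k} (p : Walk x v k) → OnWalk x p
    later : ∀ {u w v k} (e : Adj u w) (p : Walk w v k) → OnWalk x p → OnWalk x (step e p)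

  IsShortest : ∀ {u v k} → Walk u v k → Set
  IsShortest {u} {v} {k} p = ∀ k' → Walk u v k' → k ≤ k'

  Convex : Subset n → Set
  Convex C = ∀ u v → u ∈ C → v ∈ C → ∀ k (p : Walk u v k) → IsShortest p →
             ∀ x → OnWalk x p → x ∈ C

  InHull : Subset n → Fin n → Set
  InHull P x = ∀ C → Convex C → P ⊆ C → x ∈ C

  Generating : Subset n → Set
  Generating P = ∀ x → InHull P x

  ConnectedWithin : (Fin n → Set) → Fin n → Fin n → Set
  ConnectedWithin S u v = ∃ λ k → Σ (Walk u v k) λ p → ∀ x → OnWalk x p → S x

  ConnectedSet : Subset n → Set
  ConnectedSet B = (∃ λ v → v ∈ B) ×
                   (∀ u v → u ∈ B → v ∈ B → ConnectedWithin (_∈ B) u v)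

  CutVertex : Subset n → Fin n → Set
  CutVertex B x = x ∈ B × ∃ λ u → ∃ λ w → u ∈ B × w ∈ B × u ≢ x × w ≢ x ×
                  ¬ ConnectedWithin (λ y → y ∈ B × y ≢ x) u w

  Nonseparable : Subset n → Set
  Nonseparable B = ConnectedSet B × ¬ (∃ λ x → CutVertex B x)

  IsBlock : Subset n → Set
  IsBlock B = Nonseparable B × (∀ B' → B ⊆ B' → Nonseparable B' → B' ⊆ B)

  BlockGraph : Set
  BlockGraph = ∀ B → IsBlock B → ∀ u v → u ∈ B → v ∈ B → u ≢ v → Adj u v

  -- NimGEN P m : the position of GEN(G) in which the set P has been selected
  -- has nim-number m.  A position is terminal iff P is generating; otherwise
  -- the options are P ∪ {v} for unselected v, and the nim-number is the mex
  -- of the nim-numbers of the options.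
  data NimGEN : Subset n → ℕ → Set where
    ended   : ∀ {P} → Generating P → NimGEN P 0
    ongoing : ∀ {P m} → ¬ Generating P →
              (∀ v → v ∉ P → ∃ λ m' → NimGEN (P ∪ ⁅ v ⁆) m' × m' ≢ m) →
              (∀ j → j < m → ∃ λ v → v ∉ P × NimGEN (P ∪ ⁅ v ⁆) j) →
              NimGEN P m

module Submission where

-- A vertex is simplicial if its neighbours are pairwise adjacent. For simplicial v
-- the complement of {v} is convex, since a geodesic through v could be shortcut
-- across its neighbourhood; so every generating set contains all simplicial
-- vertices. Conversely, in a block graph every vertex x lies on a geodesic between
-- two simplicial vertices: a geodesic from x ending in a non-simplicial w extends
-- past w, for otherwise two non-adjacent neighbours of w, both no farther from x
-- than w, would be joined by a walk avoiding w; together with w this closes a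
-- cycle, which lies in one block and so forces the two neighbours to be adjacent.
-- Hence the generating sets are exactly the supersets of the simplicial vertices,
-- and the nim-number depends only on how many simplicial and other vertices are
-- still unselected; at the start this is the parity of n.

open import Defs
open import Data.Nat using (ℕ)
open import Data.Nat.DivMod using (_%_)
open import Data.Fin.Subset using (⊥)

open import Data.Bool using (true)
import Data.Bool.Properties as Bool
open import Data.Fin using (Fin; zero; suc)
open import Data.Fin.Properties using (_≟_; all?; injective⇒≤)
open import Data.Fin.Subset
  using (Subset; inside; outside; _∈_; _∉_; _⊆_; _⊂_; _⊃_; _∪_; _─_; _-_; ⁅_⁆; ∁; ∣_∣; Nonempty; Empty)
open import Data.Fin.Subset.Induction using (⊃-wellFounded)
open import Data.Fin.Subset.Properties
open import Data.Nat using (zero; suc; _+_; _≤_; _<_; _<?_; z≤n; s≤s)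
open import Data.Nat.DivMod using ([m+n]%n≡m%n)
open import Data.Nat.Properties
  using (suc-injective; 0≢1+n; 1+n≢n; <⇒≱; ≮⇒≥; n<1+n; +-suc; +-comm; +-identityʳ; +-monoʳ-<;
         <-trans; ≤-<-trans; m+1+n≰m; m≤n+m; m+[n∸m]≡n; ≤-trans)
open import Data.Product using (Σ; ∃-syntax; _×_; _,_; proj₂)
open import Data.Sum using (_⊎_; inj₁; inj₂; [_,_]; map₁)
open import Data.Unit using (⊤; tt)
open import Data.Vec using (_∷_; tabulate; here; there)
open import Data.Vec.Properties using (lookup∘tabulate; []=⇒lookup; lookup⇒[]=)
open import Effect.Monad using (RawMonad)
open import Function using (_∘_; id; _⇔_; Equivalence; Injective; mk⇔)
open import Induction.WellFounded using (Acc; acc)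
open import Level using (0ℓ)
open import Relation.Binary.PropositionalEquality hiding ([_])
open import Relation.Nullary using (¬_; Dec; yes; no; contradiction)
open import Relation.Nullary.Decidable
  using (_⊎-dec_; _→-dec_; ¬?; isYes; toWitness; fromWitness; decidable-stable)
open import Relation.Nullary.Decidable.Core using (¬¬-excluded-middle)
open import Relation.Nullary.Negation using (¬¬-Monad)
open import Relation.Unary using (Pred; Decidable)

open RawMonad (¬¬-Monad {a = 0ℓ})

module _ where
  private variable
    n c : ℕ
    p q : Subset n
    x y : Fin n

  toSubset : {Q : Pred (Fin n) 0ℓ} → Decidable Q → Subset n
  toSubset Q? = tabulate (λ x → isYes (Q? x))

  module _ {Q : Pred (Fin n) 0ℓ} (Q? : Decidable Q) where

    ∈-toSubset⁺ : Q x → x ∈ toSubset Q?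
    ∈-toSubset⁺ {x} Qx =
      lookup⇒[]= x _ (trans (lookup∘tabulate _ x) (Equivalence.to Bool.T-≡ (fromWitness Qx)))

    ∈-toSubset⁻ : x ∈ toSubset Q? → Q x
    ∈-toSubset⁻ {x} x∈ =
      toWitness (Equivalence.from Bool.T-≡ (trans (sym (lookup∘tabulate _ x)) ([]=⇒lookup x∈)))


  x∈p─q⇒x∉q : x ∈ p ─ q → x ∉ q
  x∈p─q⇒x∉q {p = inside ∷ p} {q = outside ∷ q} here        ()
  x∈p─q⇒x∉q {p = _      ∷ p} {q = _       ∷ q} (there x∈) (there x∈q) = x∈p─q⇒x∉q x∈ x∈q

  x∈p⇒∣p∣≡1+∣p-x∣ : x ∈ p → ∣ p ∣ ≡ suc ∣ p - x ∣
  x∈p⇒∣p∣≡1+∣p-x∣ {p = inside ∷ p}  here       = cong suc (cong ∣_∣ (sym (p─⊥≡p p)))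
  x∈p⇒∣p∣≡1+∣p-x∣ {p = inside ∷ p}  (there x∈) = cong suc (x∈p⇒∣p∣≡1+∣p-x∣ x∈)
  x∈p⇒∣p∣≡1+∣p-x∣ {p = outside ∷ p} (there x∈) = x∈p⇒∣p∣≡1+∣p-x∣ x∈

  x∉p⇒p-x≡p : x ∉ p → p - x ≡ p
  x∉p⇒p-x≡p {x = zero}  {p = inside ∷ p}  x∉ = contradiction here x∉
  x∉p⇒p-x≡p {x = zero}  {p = outside ∷ p} x∉ = cong (outside ∷_) (p─⊥≡p p)
  x∉p⇒p-x≡p {x = suc x} {p = inside ∷ p}  x∉ = cong (inside ∷_) (x∉p⇒p-x≡p (x∉ ∘ there))
  x∉p⇒p-x≡p {x = suc x} {p = outside ∷ p} x∉ = cong (outside ∷_) (x∉p⇒p-x≡p (x∉ ∘ there))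

  Empty⇒∣p∣≡0 : ∀ {n} {p : Subset n} → Empty p → ∣ p ∣ ≡ 0
  Empty⇒∣p∣≡0 {n} empty = trans (cong ∣_∣ (Empty-unique empty)) (∣⊥∣≡0 n)

  ∣p∣≡1+c⇒Nonempty : ∣ p ∣ ≡ suc c → Nonempty p
  ∣p∣≡1+c⇒Nonempty {p = p} eq with nonempty? p
  ... | yes ne = ne
  ... | no ¬ne = contradiction (trans (sym (Empty⇒∣p∣≡0 ¬ne)) eq) 0≢1+n

  ∣p∣≤1⇒x∈p⇒y∈p⇒x≡y : ∣ p ∣ ≤ 1 → x ∈ p → y ∈ p → x ≡ y
  ∣p∣≤1⇒x∈p⇒y∈p⇒x≡y {p = p} {x = x} {y = y} ∣p∣≤1 x∈p y∈p = decidable-stable (x ≟ y) λ x≢y →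
    contradiction (subst (_≤ 1) (∣p∣≡2+c x≢y) ∣p∣≤1) λ { (s≤s ()) }
    where
    ∣p∣≡2+c : x ≢ y → ∣ p ∣ ≡ suc (suc ∣ p - x - y ∣)
    ∣p∣≡2+c x≢y = trans (x∈p⇒∣p∣≡1+∣p-x∣ x∈p) (cong suc (x∈p⇒∣p∣≡1+∣p-x∣ (x∈p∧x≢y⇒x∈p-y y∈p (x≢y ∘ sym))))

  ∣p─q∣≡0⇒p⊆q : ∣ p ─ q ∣ ≡ 0 → p ⊆ q
  ∣p─q∣≡0⇒p⊆q {q = q} eq {x} x∈p = decidable-stable (x ∈? q) λ x∉q →
    0≢1+n (trans (sym eq) (x∈p⇒∣p∣≡1+∣p-x∣ (x∈p∧x∉q⇒x∈p─q x∈p x∉q)))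

  p⊆q⇒∣p─q∣≡0 : p ⊆ q → ∣ p ─ q ∣ ≡ 0
  p⊆q⇒∣p─q∣≡0 {p = p} {q = q} p⊆q =
    Empty⇒∣p∣≡0 λ (x , x∈) → x∈p─q⇒x∉q x∈ (p⊆q (p─q⊆p p q x∈))

  ∣p─q∣≡1+∣p─q∪x∣ : x ∈ p → x ∉ q → ∣ p ─ q ∣ ≡ suc ∣ p ─ (q ∪ ⁅ x ⁆) ∣
  ∣p─q∣≡1+∣p─q∪x∣ {x = x} {p = p} {q = q} x∈p x∉q = begin
    ∣ p ─ q ∣                 ≡⟨ x∈p⇒∣p∣≡1+∣p-x∣ (x∈p∧x∉q⇒x∈p─q x∈p x∉q) ⟩
    suc ∣ p ─ q ─ ⁅ x ⁆ ∣     ≡⟨ cong (suc ∘ ∣_∣) (p─q─r≡p─q∪r p q ⁅ x ⁆) ⟩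
    suc ∣ p ─ (q ∪ ⁅ x ⁆) ∣   ∎
    where open ≡-Reasoning

  x∉p⇒p─q∪x≡p─q : x ∉ p → p ─ (q ∪ ⁅ x ⁆) ≡ p ─ q
  x∉p⇒p─q∪x≡p─q {x = x} {p = p} {q = q} x∉p = begin
    p ─ (q ∪ ⁅ x ⁆)  ≡⟨ p─q─r≡p─q∪r p q ⁅ x ⁆ ⟨
    p ─ q ─ ⁅ x ⁆    ≡⟨ x∉p⇒p-x≡p (x∉p ∘ p─q⊆p p q) ⟩
    p ─ q            ∎
    where open ≡-Reasoning

  ∣p∣+∣∁p∣≡n : ∀ (p : Subset n) → ∣ p ∣ + ∣ ∁ p ∣ ≡ n
  ∣p∣+∣∁p∣≡n p = trans (cong (∣ p ∣ +_) (∣∁p∣≡n∸∣p∣ p)) (m+[n∸m]≡n (∣p∣≤n p))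

module _ {n : ℕ} (Q : Subset n → Set) where

  Maximal : Subset n → Set
  Maximal B = Q B × (∀ B′ → B ⊆ B′ → Q B′ → B′ ⊆ B)

  -- Q need not be decidable, so a maximal extension is found only under double
  -- negation; every use of it below concludes a decidable statement.
  ¬¬-maximal-extension : ∀ {B} → Q B → ¬ ¬ (∃[ B′ ] B ⊆ B′ × Maximal B′)
  ¬¬-maximal-extension {B} = extend B (⊃-wellFounded B)
    where
    Extension : Subset n → Set
    Extension B = ∃[ B′ ] B ⊆ B′ × Maximal B′

    extend : ∀ B → Acc _⊃_ B → Q B → ¬ ¬ Extension B
    extend B (acc larger) QB = do
      yes (B′ , B⊂B′ , QB′) ← ¬¬-excluded-middle {A = ∃[ B′ ] B ⊂ B′ × Q B′}
        where no ¬larger → return {A = Extension B} (B , ⊆-refl , QB , λ B′ B⊆B′ QB′ {x} x∈B′ →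
                decidable-stable (x ∈? B) λ x∉B → ¬larger (B′ , ((λ {y} → B⊆B′ {y}) , x , x∈B′ , x∉B) , QB′))
      (B″ , B′⊆B″ , maximal) ← extend B′ (larger B⊂B′) QB′
      return {A = Extension B} (B″ , ⊆-trans (p⊂q⇒p⊆q B⊂B′) B′⊆B″ , maximal)

parity : ℕ → ℕ
parity 0             = 0
parity 1             = 1
parity (suc (suc m)) = parity m

parity-suc≢ : ∀ m → parity (suc m) ≢ parity m
parity-suc≢ 0             ()
parity-suc≢ 1             ()
parity-suc≢ (suc (suc m)) = parity-suc≢ m

<parity⇒≡parity-suc : ∀ {j} m → j < parity m → j ≡ parity (suc m)
<parity⇒≡parity-suc 1             (s≤s z≤n) = refl
<parity⇒≡parity-suc (suc (suc m)) j<        = <parity⇒≡parity-suc m j<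

parity≡%2 : ∀ m → parity m ≡ m % 2
parity≡%2 0             = refl
parity≡%2 1             = refl
parity≡%2 (suc (suc m)) = trans (parity≡%2 m) (trans (sym ([m+n]%n≡m%n m 2)) (cong (_% 2) (+-comm m 2)))

-- The nim-number of a position with a unselected vertices that every generating
-- set contains and b other unselected vertices (the game is over iff a = 0).
value : ℕ → ℕ → ℕ
value 0             b = 0
value 1             b = suc (parity b)
value (suc (suc a)) b = parity (a + b)

value-pred≢ : ∀ a b → value a b ≢ value (suc a) b
value-pred≢ 0             b ()
value-pred≢ 1             b = 1+n≢n
value-pred≢ (suc (suc a)) b = parity-suc≢ (a + b) ∘ sym

value-suc≢ : ∀ a b → value (suc a) b ≢ value (suc a) (suc b)
value-suc≢ 0       b = parity-suc≢ b ∘ sym ∘ suc-injective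
value-suc≢ (suc a) b eq = parity-suc≢ (a + b) (sym (trans eq (cong parity (+-suc a b))))

value-mex : ∀ a b {j} → j < value (suc a) b →
            j ≡ value a b ⊎ ∃[ b′ ] b ≡ suc b′ × j ≡ value (suc a) b′
value-mex 0             b       {zero}  _         = inj₁ refl
value-mex 0             (suc b) {suc j} (s≤s j<)  = inj₂ (b , refl , cong suc (<parity⇒≡parity-suc (suc b) j<))
value-mex 1             (suc b)         j<        = inj₂ (b , refl , <parity⇒≡parity-suc (suc b) j<)
value-mex (suc (suc a)) b               j<        = inj₁ (<parity⇒≡parity-suc (suc a + b) j<)

value≡parity : ∀ a b → (a ≤ 1 → b ≡ 0) → value a b ≡ parity (a + b)
value≡parity 0             b b≡0 rewrite b≡0 z≤n       = refl
value≡parity 1             b b≡0 rewrite b≡0 (s≤s z≤n) = refl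
value≡parity (suc (suc a)) b _                         = refl

module _ {n : ℕ} (G : Graph n) where
  open Graph G

  private variable
    a b s u v w x y z : Fin n
    i j k m : ℕ

  Adj-sym : Adj G u v → Adj G v u
  Adj-sym {u} {v} e = trans (adj-sym v u) e

  Adj⇒≢ : Adj G u v → u ≢ v
  Adj⇒≢ {u} e refl = contradiction (trans (sym e) (adj-irrefl u)) λ ()

  adj? : ∀ u v → Dec (Adj G u v)
  adj? u v = adj u v Bool.≟ true

  infixr 5 _++_
  infixl 5 _∷ʳ_
  infix 4 _∈ʷ_ _∉ʷ_ _⊆ʷ_

  _++_ : Walk G u v i → Walk G v w j → Walk G u w (i + j)
  here     ++ q = q
  step e p ++ q = step e (p ++ q)

  _∷ʳ_ : Walk G u v k → Adj G v w → Walk G u w (suc k)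
  here     ∷ʳ e = step e here
  step d p ∷ʳ e = step d (p ∷ʳ e)

  reverse : Walk G u v k → Walk G v u k
  reverse here       = here
  reverse (step e p) = reverse p ∷ʳ Adj-sym e

  _∈ʷ_ : Fin n → Walk G u v k → Set
  x ∈ʷ p = OnWalk G x p

  _∉ʷ_ : Fin n → Walk G u v k → Set
  x ∉ʷ p = ¬ x ∈ʷ p

  _⊆ʷ_ : Walk G u v i → Walk G w y j → Set
  p ⊆ʷ q = ∀ {x} → x ∈ʷ p → x ∈ʷ q

  ∈-here⁻ : x ∈ʷ here {u = u} → x ≡ u
  ∈-here⁻ (first _) = refl

  ∈-end : (p : Walk G u v k) → v ∈ʷ p
  ∈-end here       = first here
  ∈-end (step e p) = later e p (∈-end p)

  ∈-++⁺ˡ : (p : Walk G u v i) (q : Walk G v w j) → p ⊆ʷ p ++ q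
  ∈-++⁺ˡ here       q (first _)     = first q
  ∈-++⁺ˡ (step e p) q (first _)     = first _
  ∈-++⁺ˡ (step e p) q (later _ _ o) = later e _ (∈-++⁺ˡ p q o)

  ∈-++⁺ʳ : (p : Walk G u v i) (q : Walk G v w j) → q ⊆ʷ p ++ q
  ∈-++⁺ʳ here       q o = o
  ∈-++⁺ʳ (step e p) q o = later e _ (∈-++⁺ʳ p q o)

  ∈-++⁻ : (p : Walk G u v i) (q : Walk G v w j) → x ∈ʷ p ++ q → x ∈ʷ p ⊎ x ∈ʷ q
  ∈-++⁻ here       q o             = inj₂ o
  ∈-++⁻ (step e p) q (first _)     = inj₁ (first _)
  ∈-++⁻ (step e p) q (later _ _ o) = map₁ (later e p) (∈-++⁻ p q o)

  ∈-∷ʳ⁺ˡ : (p : Walk G u v k) (e : Adj G v w) → p ⊆ʷ p ∷ʳ e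
  ∈-∷ʳ⁺ˡ here       e (first _)     = first _
  ∈-∷ʳ⁺ˡ (step d p) e (first _)     = first _
  ∈-∷ʳ⁺ˡ (step d p) e (later _ _ o) = later d _ (∈-∷ʳ⁺ˡ p e o)

  ∈-∷ʳ⁻ : (p : Walk G u v k) (e : Adj G v w) → x ∈ʷ p ∷ʳ e → x ∈ʷ p ⊎ x ≡ w
  ∈-∷ʳ⁻ here       e (first _)             = inj₁ (first _)
  ∈-∷ʳ⁻ here       e (later _ _ (first _)) = inj₂ refl
  ∈-∷ʳ⁻ (step d p) e (first _)             = inj₁ (first _)
  ∈-∷ʳ⁻ (step d p) e (later _ _ o)         = map₁ (later d p) (∈-∷ʳ⁻ p e o)

  ∈-reverse⁻ : (p : Walk G u v k) → reverse p ⊆ʷ p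
  ∈-reverse⁻ here       o = o
  ∈-reverse⁻ (step e p) o with ∈-∷ʳ⁻ (reverse p) (Adj-sym e) o
  ... | inj₁ o′   = later e p (∈-reverse⁻ p o′)
  ... | inj₂ refl = first _

  ∈-reverse⁺ : (p : Walk G u v k) → p ⊆ʷ reverse p
  ∈-reverse⁺ here       o             = o
  ∈-reverse⁺ (step e p) (first _)     = ∈-end (reverse p ∷ʳ Adj-sym e)
  ∈-reverse⁺ (step e p) (later _ _ o) = ∈-∷ʳ⁺ˡ (reverse p) (Adj-sym e) (∈-reverse⁺ p o)

  _∈ʷ?_ : ∀ x (p : Walk G u v k) → Dec (x ∈ʷ p)
  x ∈ʷ? here {u = u} with x ≟ u
  ... | yes refl = yes (first _)
  ... | no x≢u   = no (x≢u ∘ ∈-here⁻)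
  x ∈ʷ? step {u = u} e p with x ≟ u | x ∈ʷ? p
  ... | yes refl | _      = yes (first _)
  ... | no _     | yes o  = yes (later e p o)
  ... | no x≢u   | no x∉p = no λ { (first _) → x≢u refl ; (later _ _ o) → x∉p o }

  data SplitAt (x : Fin n) : Walk G u v k → Set where
    split : (p : Walk G u x i) (q : Walk G x v j) → SplitAt x (p ++ q)

  splitAt : (p : Walk G u v k) → x ∈ʷ p → SplitAt x p
  splitAt p          (first _)     = split here p
  splitAt (step e p) (later _ _ o) with splitAt p o
  ... | split p₁ p₂ = split (step e p₁) p₂

  Simple : Walk G u v k → Set
  Simple here               = ⊤
  Simple (step {u = u} _ p) = u ∉ʷ p × Simple p

  Simple-++⁻ʳ : (p : Walk G u v i) {q : Walk G v w j} → Simple (p ++ q) → Simple q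
  Simple-++⁻ʳ here       sq = sq
  Simple-++⁻ʳ (step e p) sq = Simple-++⁻ʳ p (proj₂ sq)

  Simple-++-disjoint : (p : Walk G u v i) {q : Walk G v w j} → Simple (p ++ q) →
                       x ∈ʷ p → x ∈ʷ q → x ≡ v
  Simple-++-disjoint here       _        o             _  = ∈-here⁻ o
  Simple-++-disjoint (step e p) (u∉ , _) (first _)     o′ = contradiction (∈-++⁺ʳ p _ o′) u∉
  Simple-++-disjoint (step e p) (_ , s)  (later _ _ o) o′ = Simple-++-disjoint p s o o′

  simplify : (p : Walk G u v k) → ∃[ k′ ] Σ (Walk G u v k′) λ q → Simple q × q ⊆ʷ p
  simplify here = 0 , here , tt , id
  simplify (step {u = u} e p) with simplify p
  ... | k′ , q , sq , q⊆p with u ∈ʷ? q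
  ...   | no u∉q = suc k′ , step e q , (u∉q , sq) , λ { (first _) → first _ ; (later _ _ o) → later e p (q⊆p o) }
  ...   | yes u∈q with splitAt q u∈q
  ...     | split q₁ q₂ = _ , q₂ , Simple-++⁻ʳ q₁ sq , later e p ∘ q⊆p ∘ ∈-++⁺ʳ q₁ q₂

  vertex : Walk G u v k → Fin (suc k) → Fin n
  vertex {u = u} here       _       = u
  vertex {u = u} (step _ p) zero    = u
  vertex         (step _ p) (suc i) = vertex p i

  vertex-∈ : (p : Walk G u v k) (i : Fin (suc k)) → vertex p i ∈ʷ p
  vertex-∈ here       zero    = first _
  vertex-∈ (step e p) zero    = first _
  vertex-∈ (step e p) (suc i) = later e p (vertex-∈ p i)

  Simple⇒vertex-injective : (p : Walk G u v k) → Simple p → Injective _≡_ _≡_ (vertex p)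
  Simple⇒vertex-injective here       _        {zero}  {zero}  _  = refl
  Simple⇒vertex-injective (step e p) _        {zero}  {zero}  _  = refl
  Simple⇒vertex-injective (step e p) (u∉ , _) {zero}  {suc j} eq = contradiction (subst (_∈ʷ p) (sym eq) (vertex-∈ p j)) u∉
  Simple⇒vertex-injective (step e p) (u∉ , _) {suc i} {zero}  eq = contradiction (subst (_∈ʷ p) eq (vertex-∈ p i)) u∉
  Simple⇒vertex-injective (step e p) (_ , s)  {suc i} {suc j} eq = cong suc (Simple⇒vertex-injective p s eq)

  Simple⇒length< : (p : Walk G u v k) → Simple p → k < n
  Simple⇒length< p s = injective⇒≤ (Simple⇒vertex-injective p s)

  shortest⇒length< : (p : Walk G u v k) → IsShortest G p → k < n
  shortest⇒length< p sh with simplify p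
  ... | k′ , q , sq , _ = ≤-<-trans (sh k′ q) (Simple⇒length< q sq)

  reverse-shortest : (p : Walk G u v k) → IsShortest G p → IsShortest G (reverse p)
  reverse-shortest p sh k′ q = sh k′ (reverse q)

  connected-refl : {R : Fin n → Set} → R u → ConnectedWithin G R u u
  connected-refl Ru = 0 , here , λ x o → subst _ (sym (∈-here⁻ o)) Ru

  connected-sym : {R : Fin n → Set} → ConnectedWithin G R u v → ConnectedWithin G R v u
  connected-sym (k , p , R-p) = k , reverse p , λ x → R-p x ∘ ∈-reverse⁻ p

  connected-trans : {R : Fin n → Set} →
                    ConnectedWithin G R u v → ConnectedWithin G R v w → ConnectedWithin G R u w
  connected-trans (i , p , R-p) (j , q , R-q) =
    i + j , p ++ q , λ x → [ R-p x , R-q x ] ∘ ∈-++⁻ p q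

  connected-∷ʳ : {R : Fin n → Set} → ConnectedWithin G R u v → Adj G v w → R w →
                 ConnectedWithin G R u w
  connected-∷ʳ (k , p , R-p) e Rw = suc k , p ∷ʳ e , λ x → [ R-p x , (λ { refl → Rw }) ] ∘ ∈-∷ʳ⁻ p e

  Simplicial : Fin n → Set
  Simplicial v = ∀ a b → Adj G v a → Adj G v b → a ≢ b → Adj G a b

  simplicial? : ∀ v → Dec (Simplicial v)
  simplicial? v = all? λ a → all? λ b → adj? v a →-dec adj? v b →-dec ¬? (a ≟ b) →-dec adj? a b

  simplicial-shortcut : Simplicial v → Walk G v u i → Walk G v w j → u ≢ v → w ≢ v →
                        ∃[ k ] Walk G u w k × k < i + j
  simplicial-shortcut _ here _    u≢v _   = contradiction refl u≢v
  simplicial-shortcut _ _    here _   w≢v = contradiction refl w≢v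
  simplicial-shortcut {i = suc i} {j = suc j} sv (step {w = a} va p) (step {w = b} vb q) _ _
    with a ≟ b
  ... | yes refl = i + j , reverse p ++ q , <-trans (+-monoʳ-< i (n<1+n j)) (n<1+n (i + suc j))
  ... | no a≢b   = i + suc j , reverse p ++ step (sv a b va vb a≢b) q , n<1+n (i + suc j)

  simplicial⇒∁-convex : Simplicial v → Convex G (∁ ⁅ v ⁆)
  simplicial⇒∁-convex {v} sv u w u∈ w∈ k p sh x x∈p with x ≟ v
  ... | no x≢v   = x∉p⇒x∈∁p (x≢y⇒x∉⁅y⁆ x≢v)
  ... | yes refl with splitAt p x∈p
  ...   | split p₁ p₂
    with simplicial-shortcut sv (reverse p₁) p₂ (x∉⁅y⁆⇒x≢y (x∈∁p⇒x∉p u∈)) (x∉⁅y⁆⇒x≢y (x∈∁p⇒x∉p w∈))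
  ...     | k′ , q , k′<k = contradiction (sh k′ q) (<⇒≱ k′<k)

  simplicial∈generating : ∀ {P} → Generating G P → Simplicial v → v ∈ P
  simplicial∈generating {v} {P} gen sv = decidable-stable (v ∈? P) λ v∉P →
    x∈∁p⇒x∉p (gen v (∁ ⁅ v ⁆) (simplicial⇒∁-convex sv) (P⊆∁v v∉P)) (x∈⁅x⁆ v)
    where
    P⊆∁v : v ∉ P → P ⊆ ∁ ⁅ v ⁆
    P⊆∁v v∉P x∈P = x∉p⇒x∈∁p λ x∈v → v∉P (subst (_∈ P) (x∈⁅y⁆⇒x≡y v x∈v) x∈P)

  subsingleton-convex : ∀ {C} → (∀ {u v} → u ∈ C → v ∈ C → u ≡ v) → Convex G C
  subsingleton-convex _   u w u∈ w∈ _ here       _  x x∈p = subst (_∈ _) (sym (∈-here⁻ x∈p)) u∈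
  subsingleton-convex C≤1 u w u∈ w∈ _ (step e p) sh x x∈p with C≤1 u∈ w∈
  ... | refl = contradiction (sh 0 here) λ ()

  module _ (va : Adj G v a) (vb : Adj G v b) where

    on-cycle? : (q : Walk G a b k) → Decidable (λ y → y ≡ v ⊎ y ∈ʷ q)
    on-cycle? q y = y ≟ v ⊎-dec y ∈ʷ? q

    cycle : Walk G a b k → Subset n
    cycle q = toSubset (on-cycle? q)

    v∈cycle : (q : Walk G a b k) → v ∈ cycle q
    v∈cycle q = ∈-toSubset⁺ (on-cycle? q) (inj₁ refl)

    ∈ʷ⇒∈cycle : (q : Walk G a b k) → y ∈ʷ q → y ∈ cycle q
    ∈ʷ⇒∈cycle q = ∈-toSubset⁺ (on-cycle? q) ∘ inj₂

    ∈cycle⁻ : (q : Walk G a b k) → y ∈ cycle q → y ≡ v ⊎ y ∈ʷ q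
    ∈cycle⁻ q = ∈-toSubset⁻ (on-cycle? q)

    cycle-connected : (q : Walk G a b k) → y ∈ʷ q → ConnectedWithin G (_∈ cycle q) y v
    cycle-connected q y∈q with splitAt q y∈q
    ... | split q₁ q₂ =
      connected-∷ʳ (_ , q₂ , λ _ → ∈ʷ⇒∈cycle _ ∘ ∈-++⁺ʳ q₁ q₂) (Adj-sym vb) (v∈cycle _)

    cycle-connected-without-v : (q : Walk G a b k) → (∀ z → z ∈ʷ q → z ≢ v) → y ∈ʷ q →
                                ConnectedWithin G (λ z → z ∈ cycle q × z ≢ v) y a
    cycle-connected-without-v q avoid y∈q with splitAt q y∈q
    ... | split q₁ q₂ = connected-sym (_ , q₁ , λ z z∈q₁ →
      let z∈q = ∈-++⁺ˡ q₁ q₂ z∈q₁ in ∈ʷ⇒∈cycle _ z∈q , avoid z z∈q)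

    cycle-connected-without : (q : Walk G a b k) → Simple q → y ∈ʷ q → s ≢ y → s ≢ v →
                              ConnectedWithin G (λ z → z ∈ cycle q × z ≢ s) y v
    cycle-connected-without {s = s} q sq y∈q s≢y s≢v with splitAt q y∈q
    ... | split q₁ q₂ with s ∈ʷ? q₂
    ...   | no s∉q₂ = connected-∷ʳ
      (_ , q₂ , λ z z∈q₂ → ∈ʷ⇒∈cycle _ (∈-++⁺ʳ q₁ q₂ z∈q₂) , λ { refl → s∉q₂ z∈q₂ })
      (Adj-sym vb) (v∈cycle _ , s≢v ∘ sym)
    ...   | yes s∈q₂ = connected-∷ʳ
      (connected-sym (_ , q₁ , λ z z∈q₁ → ∈ʷ⇒∈cycle _ (∈-++⁺ˡ q₁ q₂ z∈q₁) ,
                                           λ { refl → s≢y (Simple-++-disjoint q₁ sq z∈q₁ s∈q₂) }))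
      (Adj-sym va) (v∈cycle _ , s≢v ∘ sym)

    cycle-nonseparable : (q : Walk G a b k) → Simple q → (∀ z → z ∈ʷ q → z ≢ v) →
                         Nonseparable G (cycle q)
    cycle-nonseparable q sq avoid =
      ((v , v∈cycle q) , λ _ _ u∈ w∈ → connected-trans (toV u∈) (connected-sym (toV w∈))) ,
      λ (s , _ , _ , _ , u∈ , w∈ , u≢s , w≢s , ¬connected) → ¬connected (cut s u∈ w∈ u≢s w≢s)
      where
      Without : Fin n → Fin n → Set
      Without s z = z ∈ cycle q × z ≢ s

      toV : y ∈ cycle q → ConnectedWithin G (_∈ cycle q) y v
      toV y∈ with ∈cycle⁻ q y∈
      ... | inj₁ refl = connected-refl y∈
      ... | inj₂ y∈q  = cycle-connected q y∈q

      toV-without : y ∈ cycle q → y ≢ s → s ≢ v → ConnectedWithin G (Without s) y v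
      toV-without y∈ y≢s s≢v with ∈cycle⁻ q y∈
      ... | inj₁ refl = connected-refl (y∈ , y≢s)
      ... | inj₂ y∈q  = cycle-connected-without q sq y∈q (y≢s ∘ sym) s≢v

      toA-without-v : y ∈ cycle q → y ≢ v → ConnectedWithin G (Without v) y a
      toA-without-v y∈ y≢v with ∈cycle⁻ q y∈
      ... | inj₁ y≡v = contradiction y≡v y≢v
      ... | inj₂ y∈q = cycle-connected-without-v q avoid y∈q

      cut : ∀ s → u ∈ cycle q → w ∈ cycle q → u ≢ s → w ≢ s → ConnectedWithin G (Without s) u w
      cut s u∈ w∈ u≢s w≢s with s ≟ v
      ... | yes refl = connected-trans (toA-without-v u∈ u≢s) (connected-sym (toA-without-v w∈ w≢s))
      ... | no s≢v   = connected-trans (toV-without u∈ u≢s s≢v) (connected-sym (toV-without w∈ w≢s s≢v))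

  GeodesicThrough : Fin n → Fin n → Fin n → Set
  GeodesicThrough x u w = ∃[ k ] Σ (Walk G u w k) λ p → IsShortest G p × x ∈ʷ p

  geodesic-sym : GeodesicThrough x u w → GeodesicThrough x w u
  geodesic-sym (k , p , sh , x∈p) = k , reverse p , reverse-shortest p sh , ∈-reverse⁺ p x∈p

  module _ (blockGraph : BlockGraph G) where

    avoidingWalk⇒Adj : Adj G v a → Adj G v b → a ≢ b → (p : Walk G a b k) →
                       (∀ z → z ∈ʷ p → z ≢ v) → Adj G a b
    avoidingWalk⇒Adj {a = a} {b = b} va vb a≢b p avoid with simplify p
    ... | _ , q , sq , q⊆p = decidable-stable (adj? a b) do
      (B , cycle⊆B , block) ← ¬¬-maximal-extension (Nonseparable G)
                                (cycle-nonseparable va vb q sq λ z → avoid z ∘ q⊆p)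
      return (blockGraph B block a b (cycle⊆B (∈ʷ⇒∈cycle va vb q (first q)))
                                     (cycle⊆B (∈ʷ⇒∈cycle va vb q (∈-end q))) a≢b)

    avoids-shortest-end : (p : Walk G u w k) → IsShortest G p → Adj G w a →
                          (q : Walk G u a i) → i ≤ k → ∀ z → z ∈ʷ q → z ≢ w
    avoids-shortest-end p sh wa q i≤k z z∈q refl with splitAt q z∈q
    ... | split q₁ here       = Adj⇒≢ wa refl
    ... | split q₁ (step _ _) = m+1+n≰m _ (≤-trans i≤k (sh _ q₁))

    ¬¬-farther-neighbour : (p : Walk G u w k) → IsShortest G p → ¬ Simplicial w →
                           ¬ ¬ (∃[ z ] Σ (Adj G w z) λ e → IsShortest G (p ∷ʳ e))
    ¬¬-farther-neighbour {u = u} {w = w} {k = k} p sh ¬sw ¬farther =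
      ¬sw λ a b wa wb a≢b → decidable-stable (adj? a b) λ ¬ab →
        closer wa λ (i , pa , i≤k) → closer wb λ (j , pb , j≤k) →
          ¬ab (avoidingWalk⇒Adj wa wb a≢b (reverse pa ++ pb) λ z →
                 [ avoids-shortest-end p sh wa pa i≤k z ∘ ∈-reverse⁻ pa
                 , avoids-shortest-end p sh wb pb j≤k z ] ∘ ∈-++⁻ (reverse pa) pb)
      where
      closer : Adj G w a → ¬ ¬ (∃[ i ] Walk G u a i × i ≤ k)
      closer e ¬closer = ¬farther (_ , e , λ k′ q →
        decidable-stable (k <? k′) λ k≮k′ → ¬closer (k′ , q , ≮⇒≥ k≮k′))

    ¬¬-geodesic-to-simplicial : GeodesicThrough x u w →
                                ¬ ¬ (∃[ w′ ] Simplicial w′ × GeodesicThrough x u w′)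
    ¬¬-geodesic-to-simplicial {x = x} {u = u} (k , p , sh , x∈p) = extend n p sh x∈p (m≤n+m n k)
      where
      extend : ∀ f {w k} (p : Walk G u w k) → IsShortest G p → x ∈ʷ p → n ≤ k + f →
               ¬ ¬ (∃[ w′ ] Simplicial w′ × GeodesicThrough x u w′)
      extend zero    {k = k} p sh _ n≤k+0 =
        contradiction (subst (n ≤_) (+-identityʳ k) n≤k+0) (<⇒≱ (shortest⇒length< p sh))
      extend (suc f) {w} {k} p sh x∈p n≤k+1+f with simplicial? w
      ... | yes sw  = return (w , sw , k , p , sh , x∈p)
      ... | no  ¬sw = do
        (_ , e , sh′) ← ¬¬-farther-neighbour p sh ¬sw
        extend f (p ∷ʳ e) sh′ (∈-∷ʳ⁺ˡ p e x∈p) (subst (n ≤_) (+-suc k f) n≤k+1+f)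

    simplicial-generating : ∀ {P} → (∀ {v} → Simplicial v → v ∈ P) → Generating G P
    simplicial-generating simplicial⊆P x C convex P⊆C = decidable-stable (x ∈? C) do
      (_ , sw , geodesic) ← ¬¬-geodesic-to-simplicial (0 , here , (λ _ _ → z≤n) , first here)
      (_ , sw′ , k , p , sh , x∈p) ← ¬¬-geodesic-to-simplicial (geodesic-sym geodesic)
      return (convex _ _ (P⊆C (simplicial⊆P sw)) (P⊆C (simplicial⊆P sw′)) k p sh x x∈p)

  simplicials : Subset n
  simplicials = toSubset simplicial?

  BlockGraph⇒generating⇔ : BlockGraph G → ∀ P → Generating G P ⇔ simplicials ⊆ P
  BlockGraph⇒generating⇔ blockGraph P = mk⇔ generating⇒ ⇒generating
    where
    generating⇒ : Generating G P → simplicials ⊆ P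
    generating⇒ gen x∈S = simplicial∈generating gen (∈-toSubset⁻ simplicial? x∈S)

    ⇒generating : simplicials ⊆ P → Generating G P
    ⇒generating S⊆P = simplicial-generating blockGraph λ sv → S⊆P (∈-toSubset⁺ simplicial? sv)

module _ {n : ℕ} (G : Graph n) (X : Subset n) (generating⇔ : ∀ P → Generating G P ⇔ X ⊆ P) where

  private variable
    P : Subset n
    v : Fin n
    a b : ℕ

  Counts : ℕ → ℕ → Subset n → Set
  Counts a b P = ∣ X ─ P ∣ ≡ a × ∣ ∁ X ─ P ∣ ≡ b

  select∈X : v ∈ X → v ∉ P → Counts (suc a) b P → Counts a b (P ∪ ⁅ v ⁆)
  select∈X v∈X v∉P (a≡ , b≡) =
    suc-injective (trans (sym (∣p─q∣≡1+∣p─q∪x∣ v∈X v∉P)) a≡) ,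
    trans (cong ∣_∣ (x∉p⇒p─q∪x≡p─q (x∈p⇒x∉∁p v∈X))) b≡

  select∉X : v ∉ X → v ∉ P → Counts a b P → ∃[ b′ ] b ≡ suc b′ × Counts a b′ (P ∪ ⁅ v ⁆)
  select∉X v∉X v∉P (a≡ , b≡) =
    _ , trans (sym b≡) (∣p─q∣≡1+∣p─q∪x∣ (x∉p⇒x∈∁p v∉X) v∉P) ,
    trans (cong ∣_∣ (x∉p⇒p─q∪x≡p─q v∉X)) a≡ , refl

  NimOnCounts : ℕ → ℕ → Set
  NimOnCounts a b = ∀ P → Counts a b P → NimGEN G P (value a b)

  nim-step : NimOnCounts a b → (∀ {b′} → b ≡ suc b′ → NimOnCounts (suc a) b′) →
             NimOnCounts (suc a) b
  nim-step {a} {b} nim-pred nim-suc P counts@(a≡ , b≡) = ongoing ¬generating options mex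
    where
    ¬generating : ¬ Generating G P
    ¬generating gen = 0≢1+n (trans (sym (p⊆q⇒∣p─q∣≡0 (Equivalence.to (generating⇔ P) gen))) a≡)

    options : ∀ v → v ∉ P → ∃[ m ] NimGEN G (P ∪ ⁅ v ⁆) m × m ≢ value (suc a) b
    options v v∉P with v ∈? X
    ... | yes v∈X = value a b , nim-pred _ (select∈X v∈X v∉P counts) , value-pred≢ a b
    ... | no  v∉X with select∉X v∉X v∉P counts
    ...   | b′ , refl , counts′ = value (suc a) b′ , nim-suc refl _ counts′ , value-suc≢ a b′

    mex : ∀ j → j < value (suc a) b → ∃[ v ] v ∉ P × NimGEN G (P ∪ ⁅ v ⁆) j
    mex j j< with value-mex a b j<
    ... | inj₁ refl with ∣p∣≡1+c⇒Nonempty a≡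
    ...   | v , v∈X─P = v , x∈p─q⇒x∉q v∈X─P ,
                        nim-pred _ (select∈X (p─q⊆p X P v∈X─P) (x∈p─q⇒x∉q v∈X─P) counts)
    mex j j< | inj₂ (b′ , refl , refl) with ∣p∣≡1+c⇒Nonempty b≡
    ...   | v , v∈∁X─P
      with select∉X (x∈∁p⇒x∉p (p─q⊆p (∁ X) P v∈∁X─P)) (x∈p─q⇒x∉q v∈∁X─P) counts
    ...     | _ , refl , counts′ = v , x∈p─q⇒x∉q v∈∁X─P , nim-suc refl _ counts′

  nim-counts : ∀ a b → NimOnCounts a b
  nim-counts zero    b       P (a≡ , _) = ended (Equivalence.from (generating⇔ P) (∣p─q∣≡0⇒p⊆q a≡))
  nim-counts (suc a) zero    = nim-step (nim-counts a zero) λ ()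
  nim-counts (suc a) (suc b) = nim-step (nim-counts a (suc b)) λ { refl → nim-counts (suc a) b }

  ∣X∣≤1⇒∣∁X∣≡0 : ∣ X ∣ ≤ 1 → ∣ ∁ X ∣ ≡ 0
  ∣X∣≤1⇒∣∁X∣≡0 ∣X∣≤1 = Empty⇒∣p∣≡0 λ (x , x∈∁X) → x∈∁p⇒x∉p x∈∁X (X-generating x X X-convex ⊆-refl)
    where
    X-generating : Generating G X
    X-generating = Equivalence.from (generating⇔ X) ⊆-refl

    X-convex : Convex G X
    X-convex = subsingleton-convex G (∣p∣≤1⇒x∈p⇒y∈p⇒x≡y ∣X∣≤1)

  nimGEN-⊥ : NimGEN G ⊥ (n % 2)
  nimGEN-⊥ = subst (NimGEN G ⊥) value≡n%2 (nim-counts _ _ ⊥ (refl , refl))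
    where
    open ≡-Reasoning
    value≡n%2 : value (∣ X ─ ⊥ ∣) (∣ ∁ X ─ ⊥ ∣) ≡ n % 2
    value≡n%2 = begin
      value (∣ X ─ ⊥ ∣) (∣ ∁ X ─ ⊥ ∣)  ≡⟨ cong₂ (λ p q → value (∣ p ∣) (∣ q ∣)) (p─⊥≡p X) (p─⊥≡p (∁ X)) ⟩
      value (∣ X ∣) (∣ ∁ X ∣)      ≡⟨ value≡parity (∣ X ∣) (∣ ∁ X ∣) ∣X∣≤1⇒∣∁X∣≡0 ⟩
      parity (∣ X ∣ + ∣ ∁ X ∣)     ≡⟨ cong parity (∣p∣+∣∁p∣≡n X) ⟩
      parity n                     ≡⟨ parity≡%2 n ⟩
      n % 2                        ∎

proposition6p18 : ∀ (n : ℕ) (G : Graph n) → BlockGraph G → NimGEN G ⊥ (n % 2)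
proposition6p18 n G blockGraph = nimGEN-⊥ G (simplicials G) (BlockGraph⇒generating⇔ G blockGraph)
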